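{- Let $t\ge 3$ be an integer. For every deterministic online algorithm $ALG$ for the online dominating set problem, the strict competitive ratio of $ALG$ on $K_{1,t}$-free input graphs is at least $t-1$: there is an input whose graph is $K_{1,t}$-free on which $ALG \ge (t-1)\cdot OPT$.
   Context: Online dominating set model: an input is a finite, connected, simple, undirected graph $G=(V,E)$ together with an ordering $v_1,\dots,v_n$ of $V$ chosen by an adversary such that for every $i$ the subgraph induced on $\{v_1,\dots,v_i\}$ is connected. At step $i$, $v_i$ is revealed together with its entire closed neighbourhood $N[v_i]$ (including not yet revealed neighbours), and the algorithm irrevocably decides, before the next step, whether to select $v_i$; the selected set must be a dominating set of $G$. The algorithm does not know $G$ or $n$ in advance. $ALG$ is the number of selected vertices, $OPT$ the minimum dominating set size. An algorithm has strict competitive ratio $c$ on a class if $ALG\le c\cdot OPT$ on all inputs from that class. A graph is $K_{1,t}$-free if it contains no induced subgraph isomorphic to the star $K_{1,t}$. -}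

module Defs where

open import Data.Nat using (ℕ; zero; suc; _≤_; _<_; _≤?_; NonZero)
open import Data.Nat.Properties using (≤-decTotalOrder)
open import Data.Fin using (Fin; toℕ; _≟_)
open import Data.Fin.Subset using (Subset; _∈_; ∣_∣)
open import Data.Vec using (tabulate)
open import Data.Bool using (Bool; true; false; _∨_; T)
open import Data.List using (List; map; filter; filterᵇ; allFin)
open import Data.Product using (Σ; _×_; _,_)
open import Data.Sum using (_⊎_)
open import Relation.Nullary using (¬_; does)
open import Relation.Binary.PropositionalEquality using (_≡_; _≢_)
open import Data.List.Sort.MergeSort ≤-decTotalOrder using (mergeSort)
open import Data.List.Sort.Base using (SortingAlgorithm)

sortℕ : List ℕ → List ℕ
sortℕ = SortingAlgorithm.sort mergeSort

-- A finite simple undirected graph on vertex set Fin n.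
-- The vertex with index i is the (i+1)-st vertex revealed (v_{i+1}),
-- i.e. the presentation order is the index order.
record Input : Set where
  field
    n       : ℕ
    nonempty : NonZero n
    adj     : Fin n → Fin n → Bool
    sym     : ∀ u v → adj u v ≡ adj v u
    irrefl  : ∀ u → adj u u ≡ false
    -- identifiers of the vertices, chosen by the adversary (what the algorithm sees)
    name    : Fin n → ℕ
    name-inj : ∀ u v → name u ≡ name v → u ≡ v

module _ (I : Input) where
  open Input I

  data Walk (P : Fin n → Set) : Fin n → Fin n → Set where
    here : ∀ {u} → P u → Walk P u u
    step : ∀ {u w v} → P u → adj u w ≡ true → Walk P w v → Walk P u v

  PrefixConnected : Set
  PrefixConnected = ∀ i → 1 ≤ i → i ≤ n → ∀ u v → toℕ u < i → toℕ v < i →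
                    Walk (λ k → toℕ k < i) u v

  K1-Free : ℕ → Set
  K1-Free t = ¬ (Σ (Fin n) λ c → Σ (Fin t → Fin n) λ f →
                 (∀ a b → f a ≡ f b → a ≡ b) ×
                 (∀ a → adj c (f a) ≡ true) ×
                 (∀ a b → a ≢ b → adj (f a) (f b) ≡ false))

  Dominating : Subset n → Set
  Dominating D = ∀ v → v ∈ D ⊎ Σ (Fin n) λ u → u ∈ D × adj u v ≡ true

  IsOPT : ℕ → Set
  IsOPT k = (Σ (Subset n) λ D → Dominating D × ∣ D ∣ ≡ k) ×
            (∀ D → Dominating D → k ≤ ∣ D ∣)

  closedNbhd : Fin n → List ℕ
  closedNbhd v = sortℕ (map name (filterᵇ (λ u → does (u ≟ v) ∨ adj v u) (allFin n)))

  history : Fin n → List (ℕ × List ℕ)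
  history i = map (λ j → name j , closedNbhd j)
                  (filter (λ j → toℕ j ≤? toℕ i) (allFin n))

-- A deterministic online algorithm: decides whether to select the current
-- (last revealed) vertex as a function of everything revealed so far.
OnlineAlg : Set
OnlineAlg = List (ℕ × List ℕ) → Bool

selected : OnlineAlg → (I : Input) → Subset (Input.n I)
selected alg I = tabulate (λ i → alg (history I i))

ALGcost : OnlineAlg → Input → ℕ
ALGcost alg I = ∣ selected alg I ∣

Admissible : ℕ → Input → Set
Admissible t I = PrefixConnected I × K1-Free I t

Correct : ℕ → OnlineAlg → Set
Correct t alg = ∀ I → Admissible t I → Dominating I (selected alg I)

module Submission where

-- The adversary reveals candidate hubs y_0, y_1, ... (T = t - 1 of them at most), y_k announcing as its
-- closed neighbourhood all vertices of "world k"; since y_0, ..., y_m look the same in every world m' ≥ m,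
-- the algorithm's choices on them cannot depend on the world. If it accepts y_0, ..., y_(m-1) and
-- rejects y_m, the adversary completes world m: there y_m is adjacent to everything (so OPT = 1) and
-- carries T - m pendants adjacent to nothing else, all of which a dominating set avoiding y_m must
-- contain; the algorithm selects m + (T - m) = T vertices. If it accepts all of y_0, ..., y_(T-1),
-- world T - 1 already costs it T. Every world is covered by T cliques, so its independent sets have at
-- most T vertices and it is K_{1,t}-free.

open import Defs
open import Data.Bool using (true; false; _∨_) renaming (_≟_ to _≟ᵇ_)
open import Data.Fin using (Fin; zero; suc; toℕ; fromℕ<) renaming (_≟_ to _≟ᶠ_)
open import Data.Fin.Properties
  using ( toℕ-injective; toℕ-fromℕ<; fromℕ<-injective; toℕ<n; toℕ-inject; 0≢1+n
        ; pigeonhole; all?; ¬∀⟶∃¬-smallest )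
  renaming (suc-injective to Fin-suc-injective)
open import Data.Fin.Subset using (Subset; _∈_; ∣_∣; ⁅_⁆; _-_)
open import Data.Fin.Subset.Properties
  using (x∈⁅x⁆; ∣⁅x⁆∣≡1; x∈p∧x≢y⇒x∈p-y; x∈p⇒∣p-x∣<∣p∣)
open import Data.List using (List; []; _∷_; [_]; _++_; map; filter; upTo; applyUpTo; allFin; tabulate)
open import Data.List.Properties
  using ( map-cong; map-cong-local; map-∘; map-tabulate; upTo-∷ʳ
        ; filter-++; filter-accept; filter-reject; ++-identityʳ )
import Data.List.Relation.Unary.All as All
open import Data.List.Relation.Unary.All.Properties using (all-upTo)
open import Data.Nat
  using ( ℕ; zero; suc; pred; _+_; _*_; _∸_; _≤_; _<_; _≟_; _≤?_; _<?_
        ; z≤n; s≤s; s≤s⁻¹; z<s; NonZero; >-nonZero; >-nonZero⁻¹ )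
open import Data.Nat.Properties
  using ( ≤-refl; ≤-reflexive; ≤-trans; <-trans; ≤-<-trans; <-≤-trans
        ; <⇒≤; <⇒≱; ≤⇒≯; <⇒≢; ≮⇒≥; ≰⇒>; <-irrefl
        ; <-cmp; m<n⇒m<1+n; m≤n⇒m<n∨m≡n; n≢0⇒n>0; <⇒≤pred; m≤pred[n]⇒suc[m]≤n
        ; m≤m+n; m≤m*n; +-comm; +-monoˡ-≤; +-monoʳ-≤; +-monoʳ-<; +-cancelˡ-≡; m+n≡0⇒m≡0
        ; *-monoˡ-≤; *-identityˡ; *-identityʳ
        ; m∸n≤m; ∸-monoˡ-<; ∸-cancelʳ-≡; m+n∸m≡n; m+[n∸m]≡n
        ; module ≤-Reasoning )
open import Data.Nat.Induction using (<-wellFounded)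
open import Data.Product using (Σ; ∃-syntax; _×_; _,_)
open import Data.Sum using (_⊎_; inj₁; inj₂; swap)
open import Data.Vec.Properties using (lookup∘tabulate; lookup⇒[]=; []=⇒lookup)
open import Function using (_∘_; id; flip)
open import Function.Bundles using (mk⇔)
open import Function.Definitions using (Injective)
open import Induction.WellFounded using (Acc; acc)
open import Relation.Binary.Definitions using (tri<; tri≈; tri>)
open import Relation.Binary.PropositionalEquality hiding ([_])
open import Relation.Nullary using (Dec; yes; no; does; ¬_; contradiction; _×-dec_; _⊎-dec_)
open import Relation.Nullary.Decidable using (dec-true; dec-false; does-⇔; map′)
open import Relation.Unary using (Pred; Decidable)

module _ {p} {P : Pred ℕ p} (P? : Decidable P) where

  filter-upTo-suc : ∀ n → filter P? (upTo (suc n)) ≡ filter P? (upTo n) ++ filter P? [ n ]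
  filter-upTo-suc n = trans (cong (filter P?) (sym (upTo-∷ʳ n))) (filter-++ P? (upTo n) [ n ])

  filter-upTo : ∀ {k n} → k ≤ n → (∀ {u} → u < k → P u) → (∀ {u} → k ≤ u → u < n → ¬ P u) →
                filter P? (upTo n) ≡ upTo k
  filter-upTo {n = zero} z≤n _ _ = refl
  filter-upTo {k} {suc n} k≤1+n below above with m≤n⇒m<n∨m≡n k≤1+n
  ... | inj₁ (s≤s k≤n) = begin
    filter P? (upTo (suc n))              ≡⟨ filter-upTo-suc n ⟩
    filter P? (upTo n) ++ filter P? [ n ] ≡⟨ cong₂ _++_ (filter-upTo k≤n below (λ k≤u → above k≤u ∘ m<n⇒m<1+n))
                                                        (filter-reject P? (above k≤n ≤-refl)) ⟩
    upTo k ++ []                          ≡⟨ ++-identityʳ (upTo k) ⟩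
    upTo k                                ∎
    where open ≡-Reasoning
  ... | inj₂ refl = begin
    filter P? (upTo (suc n))              ≡⟨ filter-upTo-suc n ⟩
    filter P? (upTo n) ++ filter P? [ n ] ≡⟨ cong₂ _++_ (filter-upTo ≤-refl (below ∘ m<n⇒m<1+n)
                                                                    (λ n≤u → contradiction n≤u ∘ <⇒≱))
                                                        (filter-accept P? (below ≤-refl)) ⟩
    upTo n ++ [ n ]                       ≡⟨ upTo-∷ʳ n ⟩
    upTo (suc n)                          ∎
    where open ≡-Reasoning

map-filter : ∀ {a b p q} {A : Set a} {B : Set b} {P : Pred A p} {Q : Pred B q}
             (P? : Decidable P) (Q? : Decidable Q) (f : A → B) → (∀ x → does (P? x) ≡ does (Q? (f x))) →
             ∀ xs → map f (filter P? xs) ≡ filter Q? (map f xs)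
map-filter P? Q? f same [] = refl
map-filter P? Q? f same (x ∷ xs) rewrite same x with does (Q? (f x))
... | true  = cong (f x ∷_) (map-filter P? Q? f same xs)
... | false = map-filter P? Q? f same xs

tabulate-toℕ : ∀ {a} {A : Set a} n (f : ℕ → A) → tabulate (f ∘ toℕ {n}) ≡ applyUpTo f n
tabulate-toℕ zero    f = refl
tabulate-toℕ (suc n) f = cong (f 0 ∷_) (tabulate-toℕ n (f ∘ suc))

map-toℕ-allFin : ∀ n → map toℕ (allFin n) ≡ upTo n
map-toℕ-allFin n = trans (map-tabulate id toℕ) (tabulate-toℕ n id)

does≡true⇒ : ∀ {a} {A : Set a} (a? : Dec A) → does a? ≡ true → A
does≡true⇒ (yes a) _ = a

x∈p⇒1≤∣p∣ : ∀ {n} {p : Subset n} {x} → x ∈ p → 1 ≤ ∣ p ∣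
x∈p⇒1≤∣p∣ x∈p = ≤-trans (s≤s z≤n) (x∈p⇒∣p-x∣<∣p∣ x∈p)

injective⇒≤∣p∣ : ∀ {k n} {p : Subset n} (h : Fin k → Fin n) → Injective _≡_ _≡_ h → (∀ a → h a ∈ p) →
                 k ≤ ∣ p ∣
injective⇒≤∣p∣ {zero}  h h-inj h∈p = z≤n
injective⇒≤∣p∣ {suc k} h h-inj h∈p =
  ≤-trans (s≤s (injective⇒≤∣p∣ (h ∘ suc) (Fin-suc-injective ∘ h-inj) h∘suc∈p-h₀))
          (x∈p⇒∣p-x∣<∣p∣ (h∈p zero))
  where
  h∘suc∈p-h₀ : ∀ a → h (suc a) ∈ _ - h zero
  h∘suc∈p-h₀ a = x∈p∧x≢y⇒x∈p-y (h∈p (suc a)) (0≢1+n ∘ sym ∘ h-inj)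

injectiveOn⇒≤∣p∣ : ∀ {k n} {p : Subset n} (g : ℕ → ℕ) (g<n : ∀ {a} → a < k → g a < n) →
                   (∀ {a b} → a < k → b < k → g a ≡ g b → a ≡ b) →
                   (∀ {a} → a < k → ∀ v → toℕ v ≡ g a → v ∈ p) → k ≤ ∣ p ∣
injectiveOn⇒≤∣p∣ g g<n g-inj g∈p = injective⇒≤∣p∣ h h-inj (λ a → g∈p (toℕ<n a) (h a) (toℕ-fromℕ< _))
  where
  h = λ a → fromℕ< (g<n (toℕ<n a))
  h-inj : Injective _≡_ _≡_ h
  h-inj eq = toℕ-injective (g-inj (toℕ<n _) (toℕ<n _) (fromℕ<-injective _ _ _ _ eq))

module _ (I : Input) where
  open Input I using (n; adj)

  walk-source : ∀ {P u v} → Walk I P u v → P u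
  walk-source (here pu)     = pu
  walk-source (step pu _ _) = pu

  walk-++ : ∀ {P u w v} → Walk I P u w → Walk I P w v → Walk I P u v
  walk-++ (here _)       w₂ = w₂
  walk-++ (step pu e w₁) w₂ = step pu e (walk-++ w₁ w₂)

  walk-reverse : ∀ {P u v} → Walk I P u v → Walk I P v u
  walk-reverse (here pu)     = here pu
  walk-reverse (step pu e w) =
    walk-++ (walk-reverse w) (step (walk-source w) (trans (Input.sym I _ _) e) (here pu))

  universal⇒IsOPT1 : (h : Fin n) → (∀ v → v ≢ h → adj h v ≡ true) → IsOPT I 1
  universal⇒IsOPT1 h universal = (⁅ h ⁆ , dominating , ∣⁅x⁆∣≡1 h) , lower
    where
    dominating : Dominating I ⁅ h ⁆
    dominating v with v ≟ᶠ h
    ... | yes refl = inj₁ (x∈⁅x⁆ h)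
    ... | no v≢h   = inj₂ (h , x∈⁅x⁆ h , universal v v≢h)
    lower : ∀ D → Dominating I D → 1 ≤ ∣ D ∣
    lower D D-dominating with D-dominating h
    ... | inj₁ h∈D           = x∈p⇒1≤∣p∣ h∈D
    ... | inj₂ (u , u∈D , _) = x∈p⇒1≤∣p∣ u∈D

  module _ (alg : OnlineAlg) where

    accepts⇒∈selected : ∀ v → alg (history I v) ≡ true → v ∈ selected alg I
    accepts⇒∈selected v accepts = lookup⇒[]= v _ (trans (lookup∘tabulate _ v) accepts)

    ∈selected⇒accepts : ∀ {v} → v ∈ selected alg I → alg (history I v) ≡ true
    ∈selected⇒accepts {v} v∈S = trans (sym (lookup∘tabulate _ v)) ([]=⇒lookup v∈S)

module ℕ-Graph (n : ℕ) {{n≢0 : NonZero n}} {Edge : ℕ → ℕ → Set} (edge? : ∀ u v → Dec (Edge u v)) where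

  infix 4 _~_ _~?_

  _~_ : ℕ → ℕ → Set
  u ~ v = u < v × Edge u v ⊎ v < u × Edge v u

  _~?_ : ∀ u v → Dec (u ~ v)
  u ~? v = (u <? v ×-dec edge? u v) ⊎-dec (v <? u ×-dec edge? v u)

  ~-irrefl : ∀ {u} → ¬ u ~ u
  ~-irrefl (inj₁ (u<u , _)) = <-irrefl refl u<u
  ~-irrefl (inj₂ (u<u , _)) = <-irrefl refl u<u

  graph : Input
  graph = record
    { n        = n
    ; nonempty = n≢0
    ; adj      = λ u v → does (toℕ u ~? toℕ v)
    ; sym      = λ u v → does-⇔ (mk⇔ swap swap) (toℕ u ~? toℕ v) (toℕ v ~? toℕ u)
    ; irrefl   = λ u → dec-false (toℕ u ~? toℕ u) ~-irrefl
    ; name     = toℕ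
    ; name-inj = λ _ _ → toℕ-injective
    }

  open Input graph using (adj)

  ~⇒adj : ∀ {u v : Fin n} → toℕ u ~ toℕ v → adj u v ≡ true
  ~⇒adj = dec-true (_ ~? _)

  adj⇒~ : ∀ {u v : Fin n} → adj u v ≡ true → toℕ u ~ toℕ v
  adj⇒~ = does≡true⇒ (_ ~? _)

  module _ (earlier-edge : ∀ {v} → 0 < v → v < n → ∃[ u ] u < v × Edge u v) where

    root : Fin n
    root = fromℕ< (>-nonZero⁻¹ n)

    earlier-neighbour : (x : Fin n) → 0 < toℕ x → Σ (Fin n) λ y → toℕ y < toℕ x × adj x y ≡ true
    earlier-neighbour x 0<x with earlier-edge 0<x (toℕ<n x)
    ... | u , u<x , e = y , y<x , ~⇒adj (inj₂ (y<x , subst (λ w → Edge w (toℕ x)) (sym toℕ-y) e))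
      where
      y = fromℕ< (<-trans u<x (toℕ<n x))
      toℕ-y = toℕ-fromℕ< (<-trans u<x (toℕ<n x))
      y<x = subst (_< toℕ x) (sym toℕ-y) u<x

    descend : ∀ {i} (x : Fin n) → Acc _<_ (toℕ x) → toℕ x < i → Walk graph (λ k → toℕ k < i) x root
    descend x (acc rs) x<i with toℕ x ≟ 0
    ... | yes x≡0 = subst (Walk graph _ x) (toℕ-injective (trans x≡0 (sym (toℕ-fromℕ< _)))) (here x<i)
    ... | no x≢0 with earlier-neighbour x (n≢0⇒n>0 x≢0)
    ...   | y , y<x , e = step x<i e (descend y (rs y<x) (<-trans y<x x<i))

    prefixConnected : PrefixConnected graph
    prefixConnected i _ _ u v u<i v<i =
      walk-++ graph (descend u (<-wellFounded _) u<i) (walk-reverse graph (descend v (<-wellFounded _) v<i))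

  module _ {k} (colour : ℕ → ℕ) (colour<k : ∀ {v} → v < n → colour v < k)
           (colour-clique : ∀ {u v} → u < v → v < n → colour u ≡ colour v → Edge u v) where

    sameColour⇒~ : ∀ {u v} → u ≢ v → u < n → v < n → colour u ≡ colour v → u ~ v
    sameColour⇒~ {u} {v} u≢v u<n v<n same with <-cmp u v
    ... | tri< u<v _ _ = inj₁ (u<v , colour-clique u<v v<n same)
    ... | tri≈ _ u≡v _ = contradiction u≡v u≢v
    ... | tri> _ _ v<u = inj₂ (v<u , colour-clique v<u u<n (sym same))

    K1-free : ∀ {t} → k < t → K1-Free graph t
    K1-free k<t (_ , leaf , leaf-inj , _ , leaves-independent)
      with a , b , a<b , same ← pigeonhole k<t (λ a → fromℕ< (colour<k (toℕ<n (leaf a))))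
      = contradiction (trans (sym (~⇒adj leaves-adjacent)) (leaves-independent a b a≢b)) λ ()
      where
      a≢b : a ≢ b
      a≢b refl = <-irrefl refl a<b
      leaves-adjacent : toℕ (leaf a) ~ toℕ (leaf b)
      leaves-adjacent = sameColour⇒~ (a≢b ∘ leaf-inj a b ∘ toℕ-injective) (toℕ<n (leaf a)) (toℕ<n (leaf b))
                                     (fromℕ<-injective _ _ _ _ same)

  closed? : ∀ k u → Dec (u ≡ k ⊎ k ~ u)
  closed? k u = (u ≟ k) ⊎-dec (k ~? u)

  N[_] : ℕ → List ℕ
  N[ k ] = filter (closed? k) (upTo n)

  closedNbhd-graph : ∀ v → closedNbhd graph v ≡ sortℕ N[ toℕ v ]
  closedNbhd-graph v =
    cong sortℕ (trans (map-filter _ (closed? (toℕ v)) toℕ same (allFin n)) (cong (filter _) (map-toℕ-allFin n)))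
    where
    same : ∀ u → does (u ≟ᶠ v) ∨ adj v u ≡ does (closed? (toℕ v) (toℕ u))
    same u = cong (_∨ adj v u) (does-⇔ (mk⇔ (cong toℕ) toℕ-injective) (u ≟ᶠ v) (toℕ u ≟ toℕ v))

  history-graph : ∀ i → history graph i ≡ map (λ k → k , sortℕ N[ k ]) (upTo (suc (toℕ i)))
  history-graph i = begin
    map (λ j → toℕ j , closedNbhd graph j) (filter (λ j → toℕ j ≤? toℕ i) (allFin n))
      ≡⟨ map-cong (λ j → cong (toℕ j ,_) (closedNbhd-graph j)) _ ⟩
    map (entry ∘ toℕ) (filter (λ j → toℕ j ≤? toℕ i) (allFin n))
      ≡⟨ map-∘ _ ⟩
    map entry (map toℕ (filter (λ j → toℕ j ≤? toℕ i) (allFin n)))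
      ≡⟨ cong (map entry) (map-filter _ (_≤? toℕ i) toℕ (λ _ → refl) (allFin n)) ⟩
    map entry (filter (_≤? toℕ i) (map toℕ (allFin n)))
      ≡⟨ cong (map entry ∘ filter (_≤? toℕ i)) (map-toℕ-allFin n) ⟩
    map entry (filter (_≤? toℕ i) (upTo n))
      ≡⟨ cong (map entry) (filter-upTo (_≤? toℕ i) (toℕ<n i) s≤s⁻¹ λ 1+i≤u _ → <⇒≱ 1+i≤u) ⟩
    map entry (upTo (suc (toℕ i))) ∎
    where
    open ≡-Reasoning
    entry : ℕ → ℕ × List ℕ
    entry k = k , sortℕ N[ k ]

module Adversary (T : ℕ) (1<T : 1 < T) where

  0<T : 0 < T
  0<T = <-trans z<s 1<T

  instance
    T≢0 : NonZero T
    T≢0 = >-nonZero 0<T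

  firstPendant : ℕ → ℕ
  firstPendant m = suc (m * T)

  order : ℕ → ℕ
  order k = firstPendant k + (T ∸ k)

  T<order : ∀ {k} → k < T → T < order k
  T<order {k} k<T = s≤s (begin
    T                 ≡⟨ m+[n∸m]≡n (<⇒≤ k<T) ⟨
    k + (T ∸ k)       ≤⟨ +-monoˡ-≤ (T ∸ k) (m≤m*n k T) ⟩
    k * T + (T ∸ k)   ∎)
    where open ≤-Reasoning

  <T⇒<order : ∀ {j k} → j < T → k < T → j < order k
  <T⇒<order j<T k<T = <-trans j<T (T<order k<T)

  order≤firstPendant : ∀ {k m} → k < m → order k ≤ firstPendant m
  order≤firstPendant {k} {m} k<m = s≤s (begin
    k * T + (T ∸ k)   ≤⟨ +-monoʳ-≤ (k * T) (m∸n≤m T k) ⟩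
    k * T + T         ≡⟨ +-comm (k * T) T ⟩
    suc k * T         ≤⟨ *-monoˡ-≤ T k<m ⟩
    m * T             ∎)
    where open ≤-Reasoning

  firstPendant≤order : ∀ m → firstPendant m ≤ order m
  firstPendant≤order m = m≤m+n (firstPendant m) (T ∸ m)

  order-mono : ∀ {k m} → k ≤ m → order k ≤ order m
  order-mono {k} {m} k≤m with m≤n⇒m<n∨m≡n k≤m
  ... | inj₁ k<m  = ≤-trans (order≤firstPendant k<m) (firstPendant≤order m)
  ... | inj₂ refl = ≤-refl

  m<firstPendant : ∀ m → m < firstPendant m
  m<firstPendant m = s≤s (m≤m*n m T)

  <firstPendant+ : ∀ {a m c} → a < m → a < firstPendant m + c
  <firstPendant+ {m = m} a<m = <-≤-trans (<-trans a<m (m<firstPendant m)) (m≤m+n _ _)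

  firstPendant≤1+T : ∀ {m} → m ≤ 1 → firstPendant m ≤ suc T
  firstPendant≤1+T m≤1 = s≤s (≤-trans (*-monoˡ-≤ T m≤1) (≤-reflexive (*-identityˡ T)))

  <firstPendant∧m≡0⇒≡m : ∀ {m u} → m ≡ 0 → u < firstPendant m → u ≡ m
  <firstPendant∧m≡0⇒≡m refl (s≤s z≤n) = refl

  pendant-offset< : ∀ {m v} → firstPendant m ≤ v → v < order m → v ∸ firstPendant m < T ∸ m
  pendant-offset< {m} {v} P≤v v<N =
    subst (v ∸ firstPendant m <_) (m+n∸m≡n (firstPendant m) (T ∸ m)) (∸-monoˡ-< v<N P≤v)

  -- World m has the vertices 0, ..., order m - 1, vertex k < T playing y_k; Edge m u v, for u < v, says
  -- that u and v are adjacent. Each y_u with u ≤ m is adjacent to exactly the vertices of world u; the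
  -- non-pendant vertices up to T, and those above T, form two cliques; the vertices from firstPendant m
  -- on are the pendants of y_m.
  data Edge (m u v : ℕ) : Set where
    spoke : u ≤ m → v < order u → Edge m u v
    low   : v ≤ T → v < firstPendant m → Edge m u v
    high  : T < u → v < firstPendant m → Edge m u v

  edge? : ∀ m u v → Dec (Edge m u v)
  edge? m u v = map′ from to ((u ≤? m ×-dec v <? order u) ⊎-dec (v ≤? T ×-dec v <? firstPendant m)
                                                          ⊎-dec (T <? u ×-dec v <? firstPendant m))
    where
    from : _ → Edge m u v
    from (inj₁ (u≤m , v<N))        = spoke u≤m v<N
    from (inj₂ (inj₁ (v≤T , v<P))) = low v≤T v<P
    from (inj₂ (inj₂ (T<u , v<P))) = high T<u v<P
    to : Edge m u v → _
    to (spoke u≤m v<N) = inj₁ (u≤m , v<N)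
    to (low v≤T v<P)   = inj₂ (inj₁ (v≤T , v<P))
    to (high T<u v<P)  = inj₂ (inj₂ (T<u , v<P))

  world : ℕ → Input
  world m = ℕ-Graph.graph (order m) (edge? m)

  revealed : ℕ → List (ℕ × List ℕ)
  revealed i = map (λ k → k , sortℕ (upTo (order k))) (upTo (suc i))

  module World {m} (m<T : m < T) where
    open ℕ-Graph (order m) (edge? m) public

    hub~ : ∀ {v} → v < order m → v ≢ m → m ~ v
    hub~ {v} v<N v≢m with <-cmp m v
    ... | tri< m<v _ _ = inj₁ (m<v , spoke ≤-refl v<N)
    ... | tri≈ _ m≡v _ = contradiction (sym m≡v) v≢m
    ... | tri> _ _ v<m = inj₂ (v<m , spoke (<⇒≤ v<m) (<T⇒<order m<T (<-trans v<m m<T)))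

    N[k]≡upTo-order : ∀ {k} → k ≤ m → N[ k ] ≡ upTo (order k)
    N[k]≡upTo-order {k} k≤m = filter-upTo (closed? k) (order-mono k≤m) inside (λ Nk≤u _ → outside Nk≤u)
      where
      k<T = ≤-<-trans k≤m m<T
      inside : ∀ {u} → u < order k → u ≡ k ⊎ k ~ u
      inside {u} u<Nk with <-cmp k u
      ... | tri< k<u _ _ = inj₂ (inj₁ (k<u , spoke k≤m u<Nk))
      ... | tri≈ _ k≡u _ = inj₁ (sym k≡u)
      ... | tri> _ _ u<k =
        inj₂ (inj₂ (u<k , spoke (<⇒≤ (<-≤-trans u<k k≤m)) (<T⇒<order k<T (<-trans u<k k<T))))
      outside : ∀ {u} → order k ≤ u → ¬ (u ≡ k ⊎ k ~ u)
      outside Nk≤u (inj₁ refl)                      = ≤⇒≯ Nk≤u (<T⇒<order k<T k<T)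
      outside Nk≤u (inj₂ (inj₁ (_ , spoke _ u<Nk))) = ≤⇒≯ Nk≤u u<Nk
      outside Nk≤u (inj₂ (inj₁ (_ , low u≤T _)))    = ≤⇒≯ Nk≤u (≤-<-trans u≤T (T<order k<T))
      outside Nk≤u (inj₂ (inj₁ (_ , high T<k _)))   = ≤⇒≯ (<⇒≤ T<k) k<T
      outside Nk≤u (inj₂ (inj₂ (u<k , _)))          = ≤⇒≯ Nk≤u (<-trans u<k (<T⇒<order k<T k<T))

    ~pendant⇒≡m : ∀ {u v} → firstPendant m ≤ v → u ~ v → u ≡ m
    ~pendant⇒≡m P≤v (inj₁ (_ , spoke u≤m v<Nu)) with m≤n⇒m<n∨m≡n u≤m
    ... | inj₁ u<m = contradiction (<-≤-trans v<Nu (order≤firstPendant u<m)) (≤⇒≯ P≤v)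
    ... | inj₂ u≡m = u≡m
    ~pendant⇒≡m P≤v (inj₁ (_ , low _ v<P))    = contradiction v<P (≤⇒≯ P≤v)
    ~pendant⇒≡m P≤v (inj₁ (_ , high _ v<P))   = contradiction v<P (≤⇒≯ P≤v)
    ~pendant⇒≡m P≤v (inj₂ (_ , spoke v≤m _))  = contradiction (≤-<-trans v≤m (m<firstPendant m)) (≤⇒≯ P≤v)
    ~pendant⇒≡m P≤v (inj₂ (v<u , low _ u<P))  = contradiction (<-trans v<u u<P) (≤⇒≯ P≤v)
    ~pendant⇒≡m P≤v (inj₂ (v<u , high _ u<P)) = contradiction (<-trans v<u u<P) (≤⇒≯ P≤v)

    earlier-edge : ∀ {v} → 0 < v → v < order m → ∃[ u ] u < v × Edge m u v
    earlier-edge {v} 0<v v<N with v <? order 0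
    ... | yes v<N₀ = 0 , 0<v , spoke z≤n v<N₀
    ... | no  v≮N₀ = m , <-≤-trans (<-trans m<T (T<order 0<T)) (≮⇒≥ v≮N₀) , spoke ≤-refl v<N

    -- Pendants get the colours m, ..., T - 1; for m = 0 the first of them shares colour 0 with y_0.
    colour : ℕ → ℕ
    colour v with v <? firstPendant m | v ≤? T
    ... | yes _ | yes _ = 0
    ... | yes _ | no  _ = 1
    ... | no  _ | _     = m + (v ∸ firstPendant m)

    colour<T : ∀ {v} → v < order m → colour v < T
    colour<T {v} v<N with v <? firstPendant m | v ≤? T
    ... | yes _   | yes _ = 0<T
    ... | yes _   | no  _ = 1<T
    ... | no  v≮P | _     = subst (m + (v ∸ firstPendant m) <_) (m+[n∸m]≡n (<⇒≤ m<T))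
                                  (+-monoʳ-< m (pendant-offset< {m} (≮⇒≥ v≮P) v<N))

    colour-clique : ∀ {u v} → u < v → v < order m → colour u ≡ colour v → Edge m u v
    colour-clique {u} {v} u<v v<N same with u <? firstPendant m | u ≤? T | v <? firstPendant m | v ≤? T
    ... | yes _   | yes _   | yes v<P | yes v≤T = low v≤T v<P
    ... | yes _   | yes _   | yes _   | no  _   = contradiction same λ ()
    ... | yes _   | no  u≰T | yes _   | yes v≤T = contradiction (<-≤-trans u<v v≤T) (u≰T ∘ <⇒≤)
    ... | yes _   | no  u≰T | yes v<P | no  _   = high (≰⇒> u≰T) v<P
    ... | yes u<P | yes _   | no  _   | _       =
      subst (λ w → Edge m w v) (sym (<firstPendant∧m≡0⇒≡m (m+n≡0⇒m≡0 m (sym same)) u<P)) (spoke ≤-refl v<N)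
    ... | yes u<P | no  u≰T | no  _   | _       =
      contradiction (s≤s⁻¹ (<-≤-trans u<P (firstPendant≤1+T (subst (m ≤_) (sym same) (m≤m+n m _))))) u≰T
    ... | no  u≮P | _       | yes v<P | _       = contradiction (<-trans u<v v<P) u≮P
    ... | no  u≮P | _       | no  v≮P | _       =
      contradiction (∸-cancelʳ-≡ (≮⇒≥ u≮P) (≮⇒≥ v≮P) (+-cancelˡ-≡ m _ _ same)) (<⇒≢ u<v)

    admissible : Admissible (suc T) graph
    admissible = prefixConnected earlier-edge , K1-free colour colour<T colour-clique ≤-refl

    hub : Fin (order m)
    hub = fromℕ< (<T⇒<order m<T m<T)

    isOPT : IsOPT graph 1
    isOPT = universal⇒IsOPT1 graph hub λ v v≢hub →
      ~⇒adj (subst (_~ toℕ v) (sym toℕ-hub)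
                   (hub~ (toℕ<n v) (v≢hub ∘ toℕ-injective ∘ flip trans (sym toℕ-hub))))
      where toℕ-hub = toℕ-fromℕ< (<T⇒<order m<T m<T)

    history-world : ∀ i → toℕ i ≤ m → history (world m) i ≡ revealed (toℕ i)
    history-world i i≤m = trans (history-graph i) (map-cong-local (All.map same-entry (all-upTo (suc (toℕ i)))))
      where
      same-entry : ∀ {k} → k < suc (toℕ i) → (k , sortℕ N[ k ]) ≡ (k , sortℕ (upTo (order k)))
      same-entry k≤i = cong (λ l → _ , sortℕ l) (N[k]≡upTo-order (≤-trans (s≤s⁻¹ k≤i) i≤m))

module LowerBound (T : ℕ) (1<T : 1 < T) (alg : OnlineAlg) (correct : Correct (suc T) alg) where
  open Adversary T 1<T

  Accepts : ℕ → Set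
  Accepts i = alg (revealed i) ≡ true

  accepts? : ∀ i → Dec (Accepts i)
  accepts? i = alg (revealed i) ≟ᵇ true

  -- The vertices of world m that a correct algorithm accepting y_0, ..., y_(m-1) and rejecting y_m
  -- must select: those y's and the T - m pendants.
  forced : ℕ → ℕ → ℕ
  forced m a with a <? m
  ... | yes _ = a
  ... | no  _ = firstPendant m + (a ∸ m)

  module _ {m} (m<T : m < T) where
    open World m<T

    accepted⇒selected : ∀ v → toℕ v ≤ m → Accepts (toℕ v) → v ∈ selected alg (world m)
    accepted⇒selected v v≤m accepts =
      accepts⇒∈selected (world m) alg v (trans (cong alg (history-world v v≤m)) accepts)

    pendant-selected : ¬ Accepts m → ∀ v → firstPendant m ≤ toℕ v → v ∈ selected alg (world m)
    pendant-selected rejects v P≤v with correct (world m) admissible v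
    ... | inj₁ v∈S             = v∈S
    ... | inj₂ (u , u∈S , u-v) = contradiction (subst Accepts u≡m u-accepted) rejects
      where
      u≡m = ~pendant⇒≡m P≤v (adj⇒~ u-v)
      u-accepted : Accepts (toℕ u)
      u-accepted = trans (cong alg (sym (history-world u (≤-reflexive u≡m))))
                         (∈selected⇒accepts (world m) alg u∈S)

    forced<order : ∀ {a} → a < T → forced m a < order m
    forced<order {a} a<T with a <? m
    ... | yes a<m = <T⇒<order (<-trans a<m m<T) m<T
    ... | no  a≮m = +-monoʳ-< (firstPendant m) (∸-monoˡ-< a<T (≮⇒≥ a≮m))

    forced-injective : ∀ {a b} → forced m a ≡ forced m b → a ≡ b
    forced-injective {a} {b} eq with a <? m | b <? m
    ... | yes _   | yes _   = eq
    ... | yes a<m | no  _   = contradiction eq (<⇒≢ (<firstPendant+ a<m))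
    ... | no  _   | yes b<m = contradiction (sym eq) (<⇒≢ (<firstPendant+ b<m))
    ... | no  a≮m | no  b≮m = ∸-cancelʳ-≡ (≮⇒≥ a≮m) (≮⇒≥ b≮m) (+-cancelˡ-≡ (firstPendant m) _ _ eq)

    firstRejection⇒T≤ALG : ¬ Accepts m → (∀ {a} → a < m → Accepts a) → T ≤ ALGcost alg (world m)
    firstRejection⇒T≤ALG rejects earlier =
      injectiveOn⇒≤∣p∣ (forced m) forced<order (λ _ _ → forced-injective) forced-selected
      where
      forced-selected : ∀ {a} → a < T → ∀ v → toℕ v ≡ forced m a → v ∈ selected alg (world m)
      forced-selected {a} _ v v≡f with a <? m
      ... | yes a<m = accepted⇒selected v (<⇒≤ (subst (_< m) (sym v≡f) a<m))
                                          (subst Accepts (sym v≡f) (earlier a<m))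
      ... | no  _   = pendant-selected rejects v (subst (firstPendant m ≤_) (sym v≡f) (m≤m+n _ _))

  last<T : pred T < T
  last<T = m≤pred[n]⇒suc[m]≤n ≤-refl

  allAccepted⇒T≤ALG : (∀ {a} → a < T → Accepts a) → T ≤ ALGcost alg (world (pred T))
  allAccepted⇒T≤ALG accepts = injectiveOn⇒≤∣p∣ id (λ a<T → <-trans a<T (T<order last<T)) (λ _ _ → id)
    λ a<T v v≡a → accepted⇒selected last<T v (subst (_≤ pred T) (sym v≡a) (<⇒≤pred a<T))
                                              (subst Accepts (sym v≡a) (accepts a<T))

  some-world-costs-T : ∃[ m ] Σ (m < T) λ _ → T ≤ ALGcost alg (world m)
  some-world-costs-T with all? (accepts? ∘ toℕ {T})
  ... | yes accepts =
    pred T , last<T , allAccepted⇒T≤ALG (λ a<T → subst Accepts (toℕ-fromℕ< a<T) (accepts (fromℕ< a<T)))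
  ... | no ¬accepts with i , rejects , earlier ← ¬∀⟶∃¬-smallest T _ (accepts? ∘ toℕ) ¬accepts =
    toℕ i , toℕ<n i , firstRejection⇒T≤ALG (toℕ<n i) rejects
      (λ a<i → subst Accepts (trans (toℕ-inject (fromℕ< a<i)) (toℕ-fromℕ< a<i)) (earlier (fromℕ< a<i)))

theorem7 : (t : ℕ) → 3 ≤ t → (alg : OnlineAlg) → Correct t alg →
    Σ Input λ I → Admissible t I × Σ ℕ λ k → IsOPT I k × (t ∸ 1) * k ≤ ALGcost alg I
theorem7 (suc T) (s≤s 1<T) alg correct
  with m , m<T , T≤ALG ← LowerBound.some-world-costs-T T 1<T alg correct
  = world m , admissible , 1 , isOPT , subst (_≤ ALGcost alg (world m)) (sym (*-identityʳ T)) T≤ALG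
  where
  open Adversary T 1<T
  open World m<T
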